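{- Let $G=(V,E)$ be a connected bipartite graph of order at least $3$ with stable sets $U,W$ such that $V=U\cup W$ and $1\le |U|=r\le |W|=s$. If $1\le r\le 2$, then $\lambda(\overline{G})\le\lambda(G)$.
   Context: $\overline{G}$ denotes the complement of $G$. A set $S\subseteq V$ is a locating-dominating set (LD-set) of $G$ if every vertex of $V\setminus S$ has a neighbor in $S$ and for any two distinct $u,v\in V\setminus S$, $N_G(u)\cap S\neq N_G(v)\cap S$. $\lambda(G)$ is the minimum cardinality of an LD-set of $G$. -}

module Defs where

open import Data.Nat using (ℕ; zero; suc; _≤_)
open import Data.Bool using (Bool; true; false; not)
open import Data.Fin using (Fin)
open import Data.Fin.Subset using (Subset; _∈_; _∉_; ∣_∣; ∁)
open import Data.Product using (Σ; ∃; _×_; _,_)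
open import Relation.Binary.PropositionalEquality using (_≡_; _≢_)
open import Relation.Nullary using (¬_)

record Graph (n : ℕ) : Set where
  field
    adj   : Fin n → Fin n → Bool
    sym   : ∀ u v → adj u v ≡ adj v u
    irrefl : ∀ v → adj v v ≡ false

open Graph public

Adj : ∀ {n} → Graph n → Fin n → Fin n → Set
Adj G u v = adj G u v ≡ true

open import Data.Fin using (_≟_)
open import Relation.Nullary using (yes; no)
open import Relation.Binary.PropositionalEquality using (refl; cong)

compAdj : ∀ {n} → Graph n → Fin n → Fin n → Bool
compAdj G u v with u ≟ v
... | yes _ = false
... | no _  = not (adj G u v)

private
  compAdj-sym : ∀ {n} (G : Graph n) u v → compAdj G u v ≡ compAdj G v u
  compAdj-sym G u v with u ≟ v | v ≟ u
  ... | yes _ | yes _ = refl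
  ... | yes refl | no ¬p = Data.Empty.⊥-elim (¬p refl)
    where import Data.Empty
  ... | no ¬p | yes refl = Data.Empty.⊥-elim (¬p refl)
    where import Data.Empty
  ... | no _ | no _ = cong not (sym G u v)

  compAdj-irrefl : ∀ {n} (G : Graph n) v → compAdj G v v ≡ false
  compAdj-irrefl G v with v ≟ v
  ... | yes _ = refl
  ... | no ¬p = Data.Empty.⊥-elim (¬p refl)
    where import Data.Empty

complement : ∀ {n} → Graph n → Graph n
complement G = record
  { adj = compAdj G ; sym = compAdj-sym G ; irrefl = compAdj-irrefl G }

data Reachable {n} (G : Graph n) : Fin n → Fin n → Set where
  here : ∀ {v} → Reachable G v v
  step : ∀ {u v w} → Adj G u v → Reachable G v w → Reachable G u w

Connected : ∀ {n} → Graph n → Set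
Connected G = ∀ u v → Reachable G u v

Stable : ∀ {n} → Graph n → Subset n → Set
Stable G X = ∀ u v → u ∈ X → v ∈ X → ¬ Adj G u v

IsLD : ∀ {n} → Graph n → Subset n → Set
IsLD G S =
  (∀ v → v ∉ S → ∃ λ w → w ∈ S × Adj G v w)
  × (∀ u v → u ∉ S → v ∉ S → u ≢ v →
       ¬ (∀ w → w ∈ S → (Adj G u w → Adj G v w) × (Adj G v w → Adj G u w)))

-- λ(H) ≤ λ(G): every LD-set of G is matched in size by some LD-set of H.
-- (Minima exist since V is always an LD-set, so this is exactly λ(H) ≤ λ(G).)
λ≤ : ∀ {n} → Graph n → Graph n → Set
λ≤ H G = ∀ S → IsLD G S → ∃ λ T → IsLD H T × ∣ T ∣ ≤ ∣ S ∣

{-# OPTIONS --safe #-}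
-- An LD-set S of G stays locating in the complement, since complementation preserves the
-- traces on S of the vertices outside S; it stays dominating unless some x ∉ S is adjacent to
-- all of S, and locating allows at most one such x. In a bipartite graph this x forces S to be
-- exactly the part opposite to x, and replacing a vertex p of S by x gives an LD-set of the
-- complement of the same size: x separates p from the other vertices left out, which lie in the
-- part of x. If x ∈ U there is at most one of them, as ∣ U ∣ ≤ 2; if x ∈ W then S = U = {u, u′}
-- and each of them is adjacent to exactly one of u and u′, so u′ alone separates them. If x ∈ W
-- and ∣ U ∣ = 1, a second vertex of W would also be adjacent to all of S, which is impossible.
module Submission where

open import Defs hiding (sym)
open import Data.Nat using (ℕ; suc; _≤_; _<_; _+_; _∸_; z≤n; s≤s; _≤?_)
open import Data.Nat.Properties
  using (≤-refl; ≤-trans; ≤-reflexive; ≤-pred; <⇒≱; ≰⇒>; +-suc; +-monoʳ-≤; n≤1+n; ∸-monoˡ-≤)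
open import Data.Bool using (true; not)
open import Data.Bool.Properties using (¬-not) renaming (_≟_ to _≟ᵇ_)
open import Data.Fin using (Fin; _≟_)
open import Data.Fin.Properties using (any?)
open import Data.Fin.Subset
  using (Subset; _∈_; _∉_; _⊆_; ∁; ∣_∣; ⁅_⁆; _∪_; _-_; Nonempty; inside; outside)
open import Data.Fin.Subset.Properties
  using ( _∈?_; nonempty?; Empty-unique; ∣⊥∣≡0; x∈⁅x⁆; ∣⁅x⁆∣≡1; p⊆q⇒∣p∣≤∣q∣
        ; x∈p⇒∣p-x∣<∣p∣; x∈p∧x≢y⇒x∈p-y; x∈p∪q⁺; x∉p⇒x∈∁p; x∈∁p⇒x∉p; x∉∁p⇒x∈p; ∣∁p∣≡n∸∣p∣)
open import Data.Vec using ([]; _∷_)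
open import Data.Product using (∃; ∃₂; _×_; _,_; proj₁; proj₂)
open import Data.Sum using (_⊎_; inj₁; inj₂)
open import Data.Empty using (⊥; ⊥-elim)
open import Function using (_∘_)
open import Relation.Nullary using (¬_; Dec; yes; no; ¬?; contradiction)
open import Relation.Nullary.Decidable using (decidable-stable; _×-dec_)
open import Relation.Binary.PropositionalEquality
  using (_≡_; _≢_; refl; sym; trans; cong; subst)

∣p∪q∣≤∣p∣+∣q∣ : ∀ {n} (p q : Subset n) → ∣ p ∪ q ∣ ≤ ∣ p ∣ + ∣ q ∣
∣p∪q∣≤∣p∣+∣q∣ []            []            = z≤n
∣p∪q∣≤∣p∣+∣q∣ (outside ∷ p) (outside ∷ q) = ∣p∪q∣≤∣p∣+∣q∣ p q
∣p∪q∣≤∣p∣+∣q∣ (outside ∷ p) (inside  ∷ q) =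
  ≤-trans (s≤s (∣p∪q∣≤∣p∣+∣q∣ p q)) (≤-reflexive (sym (+-suc ∣ p ∣ ∣ q ∣)))
∣p∪q∣≤∣p∣+∣q∣ (inside  ∷ p) (outside ∷ q) = s≤s (∣p∪q∣≤∣p∣+∣q∣ p q)
∣p∪q∣≤∣p∣+∣q∣ (inside  ∷ p) (inside  ∷ q) =
  s≤s (≤-trans (∣p∪q∣≤∣p∣+∣q∣ p q) (+-monoʳ-≤ ∣ p ∣ (n≤1+n ∣ q ∣)))

x∈p⇒0<∣p∣ : ∀ {n} {p : Subset n} {x} → x ∈ p → 0 < ∣ p ∣
x∈p⇒0<∣p∣ x∈p = ≤-trans (s≤s z≤n) (x∈p⇒∣p-x∣<∣p∣ x∈p)

0<∣p∣⇒Nonempty : ∀ {n} {p : Subset n} → 0 < ∣ p ∣ → Nonempty p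
0<∣p∣⇒Nonempty {n} {p} 0<∣p∣ = decidable-stable (nonempty? p) λ ¬nonempty →
  <⇒≱ 0<∣p∣ (≤-reflexive (trans (cong ∣_∣ (Empty-unique ¬nonempty)) (∣⊥∣≡0 n)))

x∈p∧∣p∣≤1+k⇒∣p-x∣≤k : ∀ {n k} {p : Subset n} {x} → x ∈ p → ∣ p ∣ ≤ suc k → ∣ p - x ∣ ≤ k
x∈p∧∣p∣≤1+k⇒∣p-x∣≤k x∈p ∣p∣≤1+k = ≤-pred (≤-trans (x∈p⇒∣p-x∣<∣p∣ x∈p) ∣p∣≤1+k)

∣p∣≤1⇒x≡y : ∀ {n} {p : Subset n} {x y} → ∣ p ∣ ≤ 1 → x ∈ p → y ∈ p → x ≡ y
∣p∣≤1⇒x≡y {x = x} {y} ∣p∣≤1 x∈p y∈p = decidable-stable (x ≟ y) λ x≢y →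
  <⇒≱ (x∈p⇒0<∣p∣ (x∈p∧x≢y⇒x∈p-y y∈p (x≢y ∘ sym))) (x∈p∧∣p∣≤1+k⇒∣p-x∣≤k x∈p ∣p∣≤1)

∣p∣≤2⇒z≡x⊎z≡y : ∀ {n} {p : Subset n} {x y z} → ∣ p ∣ ≤ 2 →
  x ∈ p → y ∈ p → z ∈ p → x ≢ y → z ≡ x ⊎ z ≡ y
∣p∣≤2⇒z≡x⊎z≡y {x = x} {z = z} ∣p∣≤2 x∈p y∈p z∈p x≢y with z ≟ x
... | yes z≡x = inj₁ z≡x
... | no  z≢x = inj₂ (∣p∣≤1⇒x≡y (x∈p∧∣p∣≤1+k⇒∣p-x∣≤k x∈p ∣p∣≤2)
                      (x∈p∧x≢y⇒x∈p-y z∈p z≢x) (x∈p∧x≢y⇒x∈p-y y∈p (x≢y ∘ sym)))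

2≤∣p∣⇒∃y≢x : ∀ {n} {p : Subset n} → 2 ≤ ∣ p ∣ → ∀ x → ∃ λ y → y ∈ p × y ≢ x
2≤∣p∣⇒∃y≢x {p = p} 2≤∣p∣ x =
  decidable-stable (any? λ y → (y ∈? p) ×-dec ¬? (y ≟ x)) λ ∄y →
    <⇒≱ 2≤∣p∣ (≤-trans (p⊆q⇒∣p∣≤∣q∣ (p⊆⁅x⁆ ∄y)) (≤-reflexive (∣⁅x⁆∣≡1 x)))
  where
  p⊆⁅x⁆ : ¬ (∃ λ y → y ∈ p × y ≢ x) → p ⊆ ⁅ x ⁆
  p⊆⁅x⁆ ∄y {y} y∈p =
    subst (_∈ ⁅ x ⁆) (sym (decidable-stable (y ≟ x) (∄y ∘ (y ,_) ∘ (y∈p ,_)))) (x∈⁅x⁆ x)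

2≤∣p∣⇒distinct-pair : ∀ {n} {p : Subset n} → 2 ≤ ∣ p ∣ → ∃₂ λ x y → x ∈ p × y ∈ p × x ≢ y
2≤∣p∣⇒distinct-pair 2≤∣p∣ with 0<∣p∣⇒Nonempty (≤-trans (s≤s z≤n) 2≤∣p∣)
... | x , x∈p with 2≤∣p∣⇒∃y≢x 2≤∣p∣ x
... | y , y∈p , y≢x = x , y , x∈p , y∈p , y≢x ∘ sym

∉∧∈⇒≢ : ∀ {n} {p : Subset n} {x y} → x ∉ p → y ∈ p → x ≢ y
∉∧∈⇒≢ x∉p y∈p refl = x∉p y∈p

exchange : ∀ {n} → Subset n → Fin n → Fin n → Subset n
exchange S y x = ⁅ x ⁆ ∪ (S - y)

x∈exchange : ∀ {n} {S : Subset n} {y x} → x ∈ exchange S y x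
x∈exchange {x = x} = x∈p∪q⁺ (inj₁ (x∈⁅x⁆ x))

z∈S∧z≢y⇒z∈exchange : ∀ {n} {S : Subset n} {y x z} → z ∈ S → z ≢ y → z ∈ exchange S y x
z∈S∧z≢y⇒z∈exchange z∈S z≢y = x∈p∪q⁺ (inj₂ (x∈p∧x≢y⇒x∈p-y z∈S z≢y))

∣exchange∣≤∣S∣ : ∀ {n} {S : Subset n} {y} x → y ∈ S → ∣ exchange S y x ∣ ≤ ∣ S ∣
∣exchange∣≤∣S∣ {S = S} {y} x y∈S = ≤-trans (∣p∪q∣≤∣p∣+∣q∣ ⁅ x ⁆ (S - y))
  (≤-trans (≤-reflexive (cong (_+ ∣ S - y ∣) (∣⁅x⁆∣≡1 x))) (x∈p⇒∣p-x∣<∣p∣ y∈S))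

module _ {n : ℕ} where

  Dominating : Graph n → Subset n → Set
  Dominating G S = ∀ v → v ∉ S → ∃ λ w → w ∈ S × Adj G v w

  SameTrace : Graph n → Subset n → Fin n → Fin n → Set
  SameTrace G S u v = ∀ w → w ∈ S → (Adj G u w → Adj G v w) × (Adj G v w → Adj G u w)

  AdjacentToAll : Graph n → Subset n → Fin n → Set
  AdjacentToAll G S x = ∀ w → w ∈ S → Adj G x w

  HasLD≤ : Graph n → ℕ → Set
  HasLD≤ H k = ∃ λ T → IsLD H T × ∣ T ∣ ≤ k

module _ {n} (G : Graph n) where

  dominating : ∀ {S} → IsLD G S → Dominating G S
  dominating = proj₁

  locating : ∀ {S} → IsLD G S → ∀ u v → u ∉ S → v ∉ S → u ≢ v → ¬ SameTrace G S u v
  locating = proj₂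

  adj? : ∀ u v → Dec (Adj G u v)
  adj? u v = adj G u v ≟ᵇ true

  adj-sym : ∀ {u v} → Adj G u v → Adj G v u
  adj-sym {u} {v} uv = trans (Graph.sym G v u) uv

  complement-adj⁺ : ∀ {u v} → u ≢ v → ¬ Adj G u v → Adj (complement G) u v
  complement-adj⁺ {u} {v} u≢v ¬uv with u ≟ v
  ... | yes u≡v = contradiction u≡v u≢v
  ... | no  _   = sym (¬-not (¬uv ∘ sym))

  complement-adj⁻ : ∀ {u v} → Adj (complement G) u v → ¬ Adj G u v
  complement-adj⁻ {u} {v} ūv uv with u ≟ v
  ... | yes _ = contradiction ūv λ ()
  ... | no  _ = contradiction (trans (cong not (sym uv)) ūv) λ ()

  stable⇒complement-adj : ∀ {P u v} → Stable G P → u ∈ P → v ∈ P → u ≢ v → Adj (complement G) u v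
  stable⇒complement-adj P-stable u∈P v∈P u≢v = complement-adj⁺ u≢v (P-stable _ _ u∈P v∈P)

  complement-sameTrace : ∀ {S u v} → u ∉ S → v ∉ S →
    SameTrace (complement G) S u v → SameTrace G S u v
  complement-sameTrace u∉S v∉S same w w∈S =
    converse (∉∧∈⇒≢ u∉S w∈S) (∉∧∈⇒≢ v∉S w∈S) (proj₂ (same w w∈S)) ,
    converse (∉∧∈⇒≢ v∉S w∈S) (∉∧∈⇒≢ u∉S w∈S) (proj₁ (same w w∈S))
    where
    converse : ∀ {u v w} → u ≢ w → v ≢ w →
      (Adj (complement G) v w → Adj (complement G) u w) → Adj G u w → Adj G v w
    converse u≢w v≢w v̄w⇒ūw uw = decidable-stable (adj? _ _) λ ¬vw →
      complement-adj⁻ (v̄w⇒ūw (complement-adj⁺ v≢w ¬vw)) uw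

  complement-isLD : ∀ {S} → IsLD G S → (∀ v → v ∉ S → ∃ λ w → w ∈ S × ¬ Adj G v w) →
    IsLD (complement G) S
  complement-isLD S-ld non-neighbour =
    (λ v v∉S → let (w , w∈S , ¬vw) = non-neighbour v v∉S in
                w , w∈S , complement-adj⁺ (∉∧∈⇒≢ v∉S w∈S) ¬vw) ,
    (λ u v u∉S v∉S u≢v → locating S-ld u v u∉S v∉S u≢v ∘ complement-sameTrace u∉S v∉S)

  non-neighbour? : ∀ S x → Dec (∃ λ w → w ∈ S × ¬ Adj G x w)
  non-neighbour? S x = any? λ w → (w ∈? S) ×-dec ¬? (adj? x w)

  complement-isLD⊎adjacentToAll : ∀ {S} → IsLD G S →
    IsLD (complement G) S ⊎ ∃ λ x → x ∉ S × AdjacentToAll G S x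
  complement-isLD⊎adjacentToAll {S} S-ld
    with any? (λ x → ¬? (x ∈? S) ×-dec ¬? (non-neighbour? S x))
  ... | yes (x , x∉S , ∄w) =
    inj₂ (x , x∉S , λ w w∈S → decidable-stable (adj? x w) (∄w ∘ (w ,_) ∘ (w∈S ,_)))
  ... | no ∄x =
    inj₁ (complement-isLD S-ld λ v v∉S →
      decidable-stable (non-neighbour? S v) (∄x ∘ (v ,_) ∘ (v∉S ,_)))

  adjacentToAll-unique : ∀ {S x y} → IsLD G S → x ∉ S → y ∉ S →
    AdjacentToAll G S x → AdjacentToAll G S y → x ≡ y
  adjacentToAll-unique {x = x} {y} S-ld x∉S y∉S x-all y-all = decidable-stable (x ≟ y) λ x≢y →
    locating S-ld x y x∉S y∉S x≢y λ w w∈S → (λ _ → y-all w w∈S) , (λ _ → x-all w w∈S)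

  adjacentToAll⇒∉ : ∀ {P S x w} → Stable G P → x ∈ P → AdjacentToAll G S x → w ∈ S → w ∉ P
  adjacentToAll⇒∉ P-stable x∈P x-all w∈S w∈P = P-stable _ _ x∈P w∈P (x-all _ w∈S)

  stable∧dominating⇒⊆ : ∀ {Q S} → Stable G Q → S ⊆ Q → Dominating G S → Q ⊆ S
  stable∧dominating⇒⊆ {S = S} Q-stable S⊆Q S-dom {v} v∈Q =
    decidable-stable (v ∈? S) λ v∉S → let (w , w∈S , vw) = S-dom v v∉S in
      Q-stable _ _ v∈Q (S⊆Q w∈S) vw

  -- If S ⊆ {a, b} and some x ∉ S is adjacent to both, every other vertex outside S is adjacent
  -- to exactly one of a and b, so its trace on S is determined by its adjacency to a.
  sameTrace-on-pair : ∀ {S x a b u v} → IsLD G S → x ∉ S → AdjacentToAll G S x →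
    (∀ {w} → w ∈ S → w ≡ a ⊎ w ≡ b) → u ∉ S → v ∉ S → u ≢ x → v ≢ x →
    (Adj G u a → Adj G v a) × (Adj G v a → Adj G u a) → SameTrace G S u v
  sameTrace-on-pair {S} {x} {a} {b} S-ld x∉S x-all S⊆ab u∉S v∉S u≢x v≢x a-iff w w∈S
    with S⊆ab w∈S
  ... | inj₁ refl = a-iff
  ... | inj₂ refl = transfer-b u∉S v∉S u≢x (proj₂ a-iff) , transfer-b v∉S u∉S v≢x (proj₁ a-iff)
    where
    not-both : ∀ {q} → q ∉ S → q ≢ x → Adj G q a → ¬ Adj G q b
    not-both q∉S q≢x qa qb = q≢x (adjacentToAll-unique S-ld q∉S x∉S q-all x-all)
      where
      q-all : AdjacentToAll G S _
      q-all w w∈S with S⊆ab w∈S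
      ... | inj₁ refl = qa
      ... | inj₂ refl = qb
    one-of : ∀ {q} → q ∉ S → ¬ Adj G q a → Adj G q b
    one-of {q} q∉S ¬qa with dominating S-ld q q∉S
    ... | w , w∈S , qw with S⊆ab w∈S
    ...   | inj₁ refl = contradiction qw ¬qa
    ...   | inj₂ refl = qw
    transfer-b : ∀ {u v} → u ∉ S → v ∉ S → u ≢ x → (Adj G v a → Adj G u a) → Adj G u b → Adj G v b
    transfer-b u∉S v∉S u≢x va⇒ua ub = one-of v∉S λ va → not-both u∉S u≢x (va⇒ua va) ub

  -- Outside exchange S p x lie only p and vertices of Q other than x; in the complement p is
  -- dominated by p′ and the others by x, which also separates p from them since x ~ p in G.
  exchange-isLD : ∀ {P Q S p p′ x} → Stable G P → Stable G Q →
    p ∈ P → p′ ∈ P → p′ ∈ S → p′ ≢ p → x ∈ Q → Adj G x p → (∀ {v} → v ∉ S → v ∈ Q) →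
    (∀ u v → u ∉ S → v ∉ S → u ≢ x → v ≢ x → u ≢ v → ¬ SameTrace G (exchange S p x) u v) →
    IsLD (complement G) (exchange S p x)
  exchange-isLD {S = S} {p} {p′} {x} P-stable Q-stable p∈P p′∈P p′∈S p′≢p x∈Q xp ∁S⊆Q separated =
    dominates , locates
    where
    T = exchange S p x

    left-out : ∀ {v} → v ∉ T → v ≢ p → v ∉ S × v ≢ x
    left-out v∉T v≢p = v∉T ∘ (λ v∈S → z∈S∧z≢y⇒z∈exchange v∈S v≢p) , ∉∧∈⇒≢ v∉T x∈exchange

    x-adj : ∀ {v} → v ∉ T → v ≢ p → Adj (complement G) v x
    x-adj v∉T v≢p = let (v∉S , v≢x) = left-out v∉T v≢p in
      stable⇒complement-adj Q-stable (∁S⊆Q v∉S) x∈Q v≢x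

    dominates : Dominating (complement G) T
    dominates v v∉T with v ≟ p
    ... | yes refl =
      p′ , z∈S∧z≢y⇒z∈exchange p′∈S p′≢p , stable⇒complement-adj P-stable p∈P p′∈P (p′≢p ∘ sym)
    ... | no  v≢p  = x , x∈exchange , x-adj v∉T v≢p

    p≁̄x : ¬ Adj (complement G) p x
    p≁̄x p̄x = complement-adj⁻ p̄x (adj-sym xp)

    locates : ∀ u v → u ∉ T → v ∉ T → u ≢ v → ¬ SameTrace (complement G) T u v
    locates u v u∉T v∉T u≢v same with u ≟ p | v ≟ p
    ... | yes refl | yes refl = u≢v refl
    ... | yes refl | no  v≢p  = p≁̄x (proj₂ (same x x∈exchange) (x-adj v∉T v≢p))
    ... | no  u≢p  | yes refl = p≁̄x (proj₁ (same x x∈exchange) (x-adj u∉T u≢p))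
    ... | no  u≢p  | no  v≢p  =
      let (u∉S , u≢x) = left-out u∉T u≢p ; (v∉S , v≢x) = left-out v∉T v≢p in
      separated u v u∉S v∉S u≢x v≢x u≢v (complement-sameTrace u∉T v∉T same)

module _ {n} (G : Graph n) {U S : Subset n} {x : Fin n}
         (U-stable : Stable G U) (W-stable : Stable G (∁ U))
         (S-ld : IsLD G S) (x∉S : x ∉ S) (x-all : AdjacentToAll G S x) where

  HasLD≤-complement-if-x∈U : x ∈ U → ∣ U ∣ ≤ 2 → 2 ≤ ∣ ∁ U ∣ → HasLD≤ (complement G) ∣ S ∣
  HasLD≤-complement-if-x∈U x∈U ∣U∣≤2 2≤∣W∣ with 2≤∣p∣⇒distinct-pair 2≤∣W∣
  ... | w , w′ , w∈W , w′∈W , w≢w′ =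
    exchange S w x ,
    exchange-isLD G W-stable U-stable w∈W w′∈W (W⊆S w′∈W) (w≢w′ ∘ sym) x∈U (x-all w (W⊆S w∈W))
      ∁S⊆U separated ,
    ∣exchange∣≤∣S∣ x (W⊆S w∈W)
    where
    W⊆S : ∁ U ⊆ S
    W⊆S = stable∧dominating⇒⊆ G W-stable (x∉p⇒x∈∁p ∘ adjacentToAll⇒∉ G U-stable x∈U x-all)
            (dominating G S-ld)

    ∁S⊆U : ∀ {v} → v ∉ S → v ∈ U
    ∁S⊆U {v} v∉S = decidable-stable (v ∈? U) (v∉S ∘ W⊆S ∘ x∉p⇒x∈∁p)

    -- Since ∣ U ∣ ≤ 2, at most one vertex besides x lies outside S.
    separated : ∀ u v → u ∉ S → v ∉ S → u ≢ x → v ≢ x → u ≢ v →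
      ¬ SameTrace G (exchange S w x) u v
    separated u v u∉S v∉S u≢x v≢x u≢v _
      with ∣p∣≤2⇒z≡x⊎z≡y ∣U∣≤2 x∈U (∁S⊆U u∉S) (∁S⊆U v∉S) (u≢x ∘ sym)
    ... | inj₁ v≡x = v≢x v≡x
    ... | inj₂ v≡u = u≢v (sym v≡u)

  x∈W-impossible-if-∣U∣≤1 : x ∉ U → ∣ U ∣ ≤ 1 → 2 ≤ ∣ ∁ U ∣ → ⊥
  x∈W-impossible-if-∣U∣≤1 x∉U ∣U∣≤1 2≤∣W∣ with 2≤∣p∣⇒∃y≢x 2≤∣W∣ x
  ... | y , y∈W , y≢x = y≢x (adjacentToAll-unique G S-ld y∉S x∉S y-all x-all)
    where
    S⊆U : S ⊆ U
    S⊆U = x∉∁p⇒x∈p ∘ adjacentToAll⇒∉ G W-stable (x∉p⇒x∈∁p x∉U) x-all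

    y∉S : y ∉ S
    y∉S = x∈∁p⇒x∉p y∈W ∘ S⊆U

    y-all : AdjacentToAll G S y
    y-all w w∈S with dominating G S-ld y y∉S
    ... | w′ , w′∈S , yw′ = subst (Adj G y) (∣p∣≤1⇒x≡y ∣U∣≤1 (S⊆U w′∈S) (S⊆U w∈S)) yw′

  HasLD≤-complement-if-x∈W : x ∉ U → ∣ U ∣ ≤ 2 → 2 ≤ ∣ U ∣ → HasLD≤ (complement G) ∣ S ∣
  HasLD≤-complement-if-x∈W x∉U ∣U∣≤2 2≤∣U∣ with 2≤∣p∣⇒distinct-pair 2≤∣U∣
  ... | u , u′ , u∈U , u′∈U , u≢u′ =
    exchange S u x ,
    exchange-isLD G U-stable W-stable u∈U u′∈U (U⊆S u′∈U) u′≢u x∈W (x-all u (U⊆S u∈U))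
      (λ v∉S → x∉p⇒x∈∁p (v∉S ∘ U⊆S)) separated ,
    ∣exchange∣≤∣S∣ x (U⊆S u∈U)
    where
    u′≢u = u≢u′ ∘ sym
    x∈W = x∉p⇒x∈∁p x∉U

    S⊆U : S ⊆ U
    S⊆U = x∉∁p⇒x∈p ∘ adjacentToAll⇒∉ G W-stable x∈W x-all

    U⊆S : U ⊆ S
    U⊆S = stable∧dominating⇒⊆ G U-stable S⊆U (dominating G S-ld)

    separated : ∀ v v′ → v ∉ S → v′ ∉ S → v ≢ x → v′ ≢ x → v ≢ v′ →
      ¬ SameTrace G (exchange S u x) v v′
    separated v v′ v∉S v′∉S v≢x v′≢x v≢v′ same =
      locating G S-ld v v′ v∉S v′∉S v≢v′
        (sameTrace-on-pair G S-ld x∉S x-all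
          (λ w∈S → ∣p∣≤2⇒z≡x⊎z≡y ∣U∣≤2 u′∈U u∈U (S⊆U w∈S) u′≢u)
          v∉S v′∉S v≢x v′≢x (same u′ (z∈S∧z≢y⇒z∈exchange (U⊆S u′∈U) u′≢u)))

2≤n∸r : ∀ {n r} → 3 ≤ n → 1 ≤ r → r ≤ 2 → r ≤ n ∸ r → 2 ≤ n ∸ r
2≤n∸r {r = 1}                 3≤n _ _                  _     = ∸-monoˡ-≤ 1 3≤n
2≤n∸r {r = 2}                 _   _ _                  2≤n∸2 = 2≤n∸2
2≤n∸r {r = suc (suc (suc _))} _   _ (s≤s (s≤s ())) _

λ≤-complement-bipartite : ∀ {n} {G : Graph n} {U : Subset n} → Stable G U → Stable G (∁ U) →
  ∣ U ∣ ≤ 2 → 2 ≤ ∣ ∁ U ∣ → λ≤ (complement G) G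
λ≤-complement-bipartite {G = G} {U} U-stable W-stable ∣U∣≤2 2≤∣W∣ S S-ld
  with complement-isLD⊎adjacentToAll G S-ld
... | inj₁ S-ld̄ = S , S-ld̄ , ≤-refl
... | inj₂ (x , x∉S , x-all) with x ∈? U | ∣ U ∣ ≤? 1
...   | yes x∈U | _ =
  HasLD≤-complement-if-x∈U G U-stable W-stable S-ld x∉S x-all x∈U ∣U∣≤2 2≤∣W∣
...   | no  x∉U | yes ∣U∣≤1 =
  ⊥-elim (x∈W-impossible-if-∣U∣≤1 G U-stable W-stable S-ld x∉S x-all x∉U ∣U∣≤1 2≤∣W∣)
...   | no  x∉U | no  ∣U∣≰1 =
  HasLD≤-complement-if-x∈W G U-stable W-stable S-ld x∉S x-all x∉U ∣U∣≤2 (≰⇒> ∣U∣≰1)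

proposition4p3 : (n : ℕ) → (G : Graph n) → (U : Subset n) → (r s : ℕ) →
    3 ≤ n → Connected G →
    Stable G U → Stable G (∁ U) →
    ∣ U ∣ ≡ r → ∣ ∁ U ∣ ≡ s → 1 ≤ r → r ≤ s → r ≤ 2 →
    λ≤ (complement G) G
proposition4p3 n G U r s 3≤n _ U-stable W-stable ∣U∣≡r ∣W∣≡s 1≤r r≤s r≤2 =
  λ≤-complement-bipartite U-stable W-stable ∣U∣≤2 2≤∣W∣
  where
  ∣U∣≤2 : ∣ U ∣ ≤ 2
  ∣U∣≤2 = subst (_≤ 2) (sym ∣U∣≡r) r≤2

  ∣W∣≡n∸r : ∣ ∁ U ∣ ≡ n ∸ r
  ∣W∣≡n∸r = trans (∣∁p∣≡n∸∣p∣ U) (cong (n ∸_) ∣U∣≡r)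

  2≤∣W∣ : 2 ≤ ∣ ∁ U ∣
  2≤∣W∣ = subst (2 ≤_) (sym ∣W∣≡n∸r)
    (2≤n∸r 3≤n 1≤r r≤2 (subst (r ≤_) (trans (sym ∣W∣≡s) ∣W∣≡n∸r) r≤s))
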